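{- Let $\ell\geq 5$ be an integer such that $\ell$ and $\ell-2$ are both prime powers. Let \[D=\{(x,y)\in\mathbb{F}_{\ell-2}\times\mathbb{F}_\ell \mid x,y \text{ are both nonzero squares, or both nonsquares, or } y=0\},\] and let $\mathcal{D}$ be the design with point set $\mathbb{F}_{\ell-2}\times\mathbb{F}_\ell$ and blocks $D+(z_1,z_2)=\{(x+z_1,y+z_2)\mid (x,y)\in D\}$ for all $(z_1,z_2)\in\mathbb{F}_{\ell-2}\times\mathbb{F}_\ell$ (this is an $\left(\ell(\ell-2), \frac{\ell^2-1}{2}-\ell, \frac{(\ell-3)(\ell+1)}{4}\right)$-BIBD). Then $\mathcal{D}$ admits an $(\ell-2)$-ULSE $\ell$-colouring.
   Context: For positive integers $v,k,\lambda$ with $2\le k<v$, a $(v,k,\lambda)$-BIBD is a pair $(V,\mathcal{B})$ where $V$ is a set of $v$ points and $\mathcal{B}$ is a collection of $k$-element subsets of $V$ (blocks) such that every pair of distinct points lies in exactly $\lambda$ blocks. An $\ell$-colouring is a surjective map from $V$ onto a set of $\ell$ colours; the colour class of a colour is the set of points mapped to it. For a nonnegative integer $t$, a $t$-ULSE $\ell$-colouring is an $\ell$-colouring such that $(\ell-1)$ divides $k-t$ and in every block $B$ some colour appears exactly $t$ times in $B$ and every other colour appears exactly $\frac{k-t}{\ell-1}$ times in $B$ (equivalently: one colour appears $t$ times and the counts of any two other colours in $B$ differ by at most $1$, with $(\ell-1)\mid(k-t)$). -}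

module Defs where

open import Level using (0ℓ)
open import Data.Nat as ℕ using (ℕ; zero; suc; _∸_)
open import Data.Nat.Divisibility using (_∣_)
open import Data.Fin using (Fin)
open import Data.Fin.Properties using (any?)
open import Data.Bool using (Bool; true; false; _∧_; _∨_; not; if_then_else_)
open import Data.Product using (Σ; ∃; _×_; _,_; proj₁; proj₂)
open import Relation.Nullary using (¬_; does)
open import Relation.Binary.Definitions using (DecidableEquality)
open import Relation.Binary.PropositionalEquality using (_≡_; _≢_)
open import Algebra.Structures using (IsCommutativeRing)
open import Algebra.Core using (Op₁; Op₂)
open import Function.Bundles using (_↔_; Inverse)

record FiniteField (q : ℕ) : Set₁ where
  field
    Carrier : Set
    _+_ : Op₂ Carrier
    _*_ : Op₂ Carrier
    -_  : Op₁ Carrier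
    0#  : Carrier
    1#  : Carrier
    isCommutativeRing : IsCommutativeRing _≡_ _+_ _*_ -_ 0# 1#
    0≢1 : 0# ≢ 1#
    inverse : ∀ x → x ≢ 0# → ∃ λ y → x * y ≡ 1#
    enum : Fin q ↔ Carrier
    _≟_ : DecidableEquality Carrier

  _-_ : Op₂ Carrier
  x - y = x + (- y)

  element : Fin q → Carrier
  element = Inverse.to enum

  -- x is a square: x = y * y for some y (0 is a square)
  IsSquare : Carrier → Set
  IsSquare x = ∃ λ y → y * y ≡ x

  isSquareB : Carrier → Bool
  isSquareB x = does (any? (λ i → (element i * element i) ≟ x))

  isZeroB : Carrier → Bool
  isZeroB x = does (x ≟ 0#)

sumFin : (n : ℕ) → (Fin n → ℕ) → ℕ
sumFin zero    f = 0
sumFin (suc n) f = f Fin.zero ℕ.+ sumFin n (λ i → f (Fin.suc i))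
  where import Data.Fin as Fin

indicator : Bool → ℕ
indicator b = if b then 1 else 0

-- The design D of the statement, for fields F of order q (= ℓ-2) and
-- G of order ℓ.  Points: F × G.  Blocks: D + (z₁ , z₂), indexed by F × G.

module DesignD {q ℓ : ℕ} (F : FiniteField q) (G : FiniteField ℓ) where
  private
    module F = FiniteField F
    module G = FiniteField G

  Point : Set
  Point = F.Carrier × G.Carrier

  inD : Point → Bool
  inD (x , y) =
       (not (F.isZeroB x) ∧ F.isSquareB x ∧ not (G.isZeroB y) ∧ G.isSquareB y)
    ∨ (not (F.isSquareB x) ∧ not (G.isSquareB y))
    ∨ G.isZeroB y

  inBlock : Point → Point → Bool
  inBlock (z₁ , z₂) (x , y) = inD (x F.- z₁ , y G.- z₂)

  countPts : (Point → Bool) → ℕ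
  countPts P = sumFin q (λ i → sumFin ℓ (λ j →
                 indicator (P (F.element i , G.element j))))

  IsColouring : (Point → Fin ℓ) → Set
  IsColouring c = ∀ col → ∃ λ p → c p ≡ col

  countIn : (Point → Fin ℓ) → Point → Fin ℓ → ℕ
  countIn c z col = countPts (λ p → inBlock z p ∧ does (c p Data.Fin.≟ col))
    where import Data.Fin

  IsULSE : (k t : ℕ) → (Point → Fin ℓ) → Set
  IsULSE k t c =
    IsColouring c ×
    ((ℓ ∸ 1) ∣ (k ∸ t)) ×
    (∀ (z : Point) → ∃ λ col₀ →
        countIn c z col₀ ≡ t ×
        (∀ col → col ≢ col₀ → countIn c z col ℕ.* (ℓ ∸ 1) ≡ k ∸ t))

IsPrimePower : ℕ → Set
IsPrimePower n = ∃ λ p → ∃ λ e → Data.Nat.Primality.Prime p × 1 ℕ.≤ e × n ≡ p ℕ.^ e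
  where import Data.Nat.Primality

-- Colour a point (x , y) by y.  The points of colour y in the block D + (z₁ , z₂) form a translate
-- of the row of D at height y - z₂: all of F when y = z₂, and otherwise the nonzero squares or the
-- nonsquares of F.  As ℓ and ℓ - 2 are prime powers two apart, ℓ - 2 is odd, so squaring is
-- two-to-one on the nonzero elements of F and both sets have (ℓ - 3) / 2 elements; this is exactly
-- (k - t) / (ℓ - 1) for k = (ℓ² - 1) / 2 - ℓ and t = ℓ - 2.
module Submission where

open import Defs
open import Data.Nat using (ℕ; _≤_; _∸_; _/_)
open import Data.Fin using (Fin)
open import Data.Product using (∃; _×_)

open import Algebra.Bundles using (CommutativeRing)
import Algebra.Properties.CommutativeMonoid.Sum as CommutativeMonoidSum
import Algebra.Properties.Ring as RingProperties
open import Data.Bool using (Bool; true; false; not; _∧_; _∨_)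
open import Data.Bool.Properties using (∧-zeroʳ; ∧-identityʳ; ∨-zeroʳ; ∨-identityʳ)
import Data.Fin as Fin
open import Data.Fin.Permutation using (Permutation′; _⟨$⟩ʳ_)
open import Data.Fin.Properties using (toℕ-injective; any?)
open import Data.Nat using (zero; suc; _^_; _<?_; s≤s; z≤n)
open import Data.Nat.DivMod using (m*n/n≡m)
open import Data.Nat.Divisibility
  using (_∣_; divides; ∣-refl; ∣m∣n⇒∣m+n; ∣m+n∣m⇒∣n; ∣⇒≤; ∣1⇒≡1; m∣m*n)
open import Data.Nat.Primality using (Prime; ¬prime[1]; prime[2]; euclidsLemma; prime⇒irreducible)
open import Data.Nat.Tactic.RingSolver using (solve-∀)
open import Data.Product using (_,_)
open import Data.Empty using (⊥-elim)
open import Data.Sum using (_⊎_; inj₁; inj₂; [_,_]′)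
open import Function.Base using (_∘_; id)
open import Function.Bundles using (_↔_; Inverse; mk↔ₛ′; mk⇔)
open import Function.Construct.Composition using (_↔-∘_)
open import Function.Construct.Symmetry using (↔-sym)
open import Level using (0ℓ)
open import Relation.Binary.Definitions using (DecidableEquality)
open import Relation.Binary.PropositionalEquality
open import Relation.Nullary using (¬_; does; yes; no; ¬?; _×-dec_; _⊎-dec_)
open import Relation.Nullary.Decidable using (dec-true; dec-false; does-⇔)
open import Relation.Nullary.Negation using (contradiction)

module FieldProperties {q : ℕ} (F : FiniteField q) where
  open FiniteField F
    using (Carrier; enum; element; inverse; 0≢1; _≟_; IsSquare; isZeroB; isSquareB; isCommutativeRing)

  commutativeRing : CommutativeRing 0ℓ 0ℓ
  commutativeRing = record { isCommutativeRing = isCommutativeRing }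

  open CommutativeRing commutativeRing
    using (_+_; _*_; -_; _-_; 0#; 1#; +-assoc; +-comm; +-identityʳ;
           *-comm; *-assoc; *-identityˡ; *-identityʳ; distribˡ; zeroʳ; ring)
  open CommutativeRing commutativeRing public using (-‿inverseʳ; zeroˡ)
  open RingProperties ring
    using (+-identityʳ-unique; +-inverseˡ-unique; -‿involutive; -‿injective; -0#≈0#;
           -‿distribˡ-*; -‿distribʳ-*; [y-z]x≈yx-zx; //-rightDividesˡ; //-rightDividesʳ)
  open RingProperties ring public using () renaming (x∙y⁻¹≈ε⇒x≈y to x-y≡0⇒x≡y)
  open ≡-Reasoning

  subtract : Carrier → Carrier ↔ Carrier
  subtract z = mk↔ₛ′ (_- z) (_+ z) (//-rightDividesʳ z) (//-rightDividesˡ z)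

  x+1≢x : ∀ x → x + 1# ≢ x
  x+1≢x x x+1≡x = 0≢1 (sym (+-identityʳ-unique x 1# x+1≡x))

  1+1≡0⇒x+1+1≡x : 1# + 1# ≡ 0# → ∀ x → x + 1# + 1# ≡ x
  1+1≡0⇒x+1+1≡x 1+1≡0 x = trans (+-assoc x 1# 1#) (trans (cong (x +_) 1+1≡0) (+-identityʳ x))

  x*y≡0⇒x≡0⊎y≡0 : ∀ x y → x * y ≡ 0# → x ≡ 0# ⊎ y ≡ 0#
  x*y≡0⇒x≡0⊎y≡0 x y xy≡0 with x ≟ 0#
  ... | yes x≡0 = inj₁ x≡0
  ... | no  x≢0 = let (w , xw≡1) = inverse x x≢0 in inj₂ (begin
    y           ≡⟨ sym (*-identityˡ y) ⟩
    1# * y      ≡⟨ cong (_* y) (trans (sym xw≡1) (*-comm x w)) ⟩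
    (w * x) * y ≡⟨ *-assoc w x y ⟩
    w * (x * y) ≡⟨ cong (w *_) xy≡0 ⟩
    w * 0#      ≡⟨ zeroʳ w ⟩
    0#          ∎)

  x≢0⇒x*x≢0 : ∀ x → x ≢ 0# → x * x ≢ 0#
  x≢0⇒x*x≢0 x x≢0 xx≡0 = [ x≢0 , x≢0 ]′ (x*y≡0⇒x≡0⊎y≡0 x x xx≡0)

  x≢0⇒-x≢0 : ∀ x → x ≢ 0# → - x ≢ 0#
  x≢0⇒-x≢0 x x≢0 -x≡0 = x≢0 (-‿injective (trans -x≡0 (sym -0#≈0#)))

  -x*-x≡x*x : ∀ x → (- x) * (- x) ≡ x * x
  -x*-x≡x*x x = begin
    (- x) * (- x) ≡⟨ sym (-‿distribˡ-* x (- x)) ⟩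
    - (x * - x)   ≡⟨ cong -_ (sym (-‿distribʳ-* x x)) ⟩
    - - (x * x)   ≡⟨ -‿involutive (x * x) ⟩
    x * x         ∎

  x*x≡y*y⇒x≡y⊎x≡-y : ∀ x y → x * x ≡ y * y → x ≡ y ⊎ x ≡ - y
  x*x≡y*y⇒x≡y⊎x≡-y x y xx≡yy with x*y≡0⇒x≡0⊎y≡0 (x - y) (x + y) difference-of-squares
    where
    difference-of-squares : (x - y) * (x + y) ≡ 0#
    difference-of-squares = begin
      (x - y) * (x + y)                 ≡⟨ [y-z]x≈yx-zx (x + y) x y ⟩
      x * (x + y) - y * (x + y)         ≡⟨ cong₂ _-_ (distribˡ x x y) (distribˡ y x y) ⟩
      (x * x + x * y) - (y * x + y * y) ≡⟨ cong₂ (λ u v → (u + x * y) - (v + y * y)) xx≡yy (*-comm y x) ⟩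
      (y * y + x * y) - (x * y + y * y) ≡⟨ cong (_- (x * y + y * y)) (+-comm (y * y) (x * y)) ⟩
      (x * y + y * y) - (x * y + y * y) ≡⟨ -‿inverseʳ _ ⟩
      0#                                ∎
  ... | inj₁ x-y≡0 = inj₁ (x-y≡0⇒x≡y x y x-y≡0)
  ... | inj₂ x+y≡0 = inj₂ (+-inverseˡ-unique x y x+y≡0)

  1+1≢0⇒x≢-x : 1# + 1# ≢ 0# → ∀ x → x ≢ 0# → x ≢ - x
  1+1≢0⇒x≢-x 1+1≢0 x x≢0 x≡-x =
    1+1≢0 ([ ⊥-elim ∘ x≢0 , id ]′ (x*y≡0⇒x≡0⊎y≡0 x (1# + 1#) x*2≡0))
    where
    x*2≡0 : x * (1# + 1#) ≡ 0#
    x*2≡0 = begin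
      x * (1# + 1#)     ≡⟨ distribˡ x 1# 1# ⟩
      x * 1# + x * 1#   ≡⟨ cong₂ _+_ (*-identityʳ x) (trans (*-identityʳ x) x≡-x) ⟩
      x + - x           ≡⟨ -‿inverseʳ x ⟩
      0#                ∎

  IsSquare⇒isSquareB : ∀ {y} → IsSquare y → isSquareB y ≡ true
  IsSquare⇒isSquareB {y} (a , a*a≡y) =
    dec-true (any? (λ i → (element i * element i) ≟ y))
             (Inverse.from enum a , trans (cong (λ u → u * u) (Inverse.strictlyInverseˡ enum a)) a*a≡y)

  isSquareB⇒IsSquare : ∀ {y} → isSquareB y ≡ true → IsSquare y
  isSquareB⇒IsSquare {y} y-square with any? (λ i → (element i * element i) ≟ y)
  ... | yes (i , e) = element i , e
  isSquareB⇒IsSquare () | no _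

  isNonzeroSquareB : Carrier → Bool
  isNonzeroSquareB x = not (isZeroB x) ∧ isSquareB x

  isSquareB≡isZeroB∨isNonzeroSquareB : ∀ x → isSquareB x ≡ isZeroB x ∨ isNonzeroSquareB x
  isSquareB≡isZeroB∨isNonzeroSquareB x with x ≟ 0#
  ... | yes refl = IsSquare⇒isSquareB (0# , zeroˡ 0#)
  ... | no  _    = refl

-- Only from here on do _+_ and _*_ (and the laws below) refer to ℕ; above they are the field operations.
open import Data.Nat using (_+_; _*_)
open import Data.Nat.Properties
  using (+-0-commutativeMonoid; *-zeroʳ; *-identityʳ; *-comm; *-assoc; +-identityʳ; +-comm;
         +-cancelˡ-≡; m+n∸n≡m; m∸n+n≡m; m≤m+n; ∸-monoˡ-≤; ≤-trans; <-asym; ≤∧≢⇒<; ≮⇒≥)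

module ∑ℕ = CommutativeMonoidSum +-0-commutativeMonoid

sumFin≡sum : ∀ n (f : Fin n → ℕ) → sumFin n f ≡ ∑ℕ.sum f
sumFin≡sum zero    f = refl
sumFin≡sum (suc n) f = cong (f Fin.zero +_) (sumFin≡sum n (f ∘ Fin.suc))

sumFin-cong : ∀ n {f g : Fin n → ℕ} → f ≗ g → sumFin n f ≡ sumFin n g
sumFin-cong zero    f≗g = refl
sumFin-cong (suc n) f≗g = cong₂ _+_ (f≗g Fin.zero) (sumFin-cong n (f≗g ∘ Fin.suc))

sumFin-const : ∀ n c → sumFin n (λ _ → c) ≡ n * c
sumFin-const zero    c = refl
sumFin-const (suc n) c = cong (c +_) (sumFin-const n c)

sumFin-distrib-+ : ∀ n (f g : Fin n → ℕ) →
                   sumFin n (λ i → f i + g i) ≡ sumFin n f + sumFin n g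
sumFin-distrib-+ n f g = begin
  sumFin n (λ i → f i + g i) ≡⟨ sumFin≡sum n _ ⟩
  ∑ℕ.sum (λ i → f i + g i)   ≡⟨ ∑ℕ.∑-distrib-+ f g ⟩
  ∑ℕ.sum f + ∑ℕ.sum g        ≡⟨ sym (cong₂ _+_ (sumFin≡sum n f) (sumFin≡sum n g)) ⟩
  sumFin n f + sumFin n g    ∎
  where open ≡-Reasoning

sumFin-comm : ∀ m n (f : Fin m → Fin n → ℕ) →
              sumFin m (λ i → sumFin n (f i)) ≡ sumFin n (λ j → sumFin m (λ i → f i j))
sumFin-comm m n f = begin
  sumFin m (λ i → sumFin n (f i))           ≡⟨ sumFin-cong m (λ i → sumFin≡sum n (f i)) ⟩
  sumFin m (λ i → ∑ℕ.sum (f i))             ≡⟨ sumFin≡sum m _ ⟩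
  ∑ℕ.sum (λ i → ∑ℕ.sum (f i))               ≡⟨ ∑ℕ.∑-comm f ⟩
  ∑ℕ.sum (λ j → ∑ℕ.sum (λ i → f i j))       ≡⟨ sym (sumFin≡sum n _) ⟩
  sumFin n (λ j → ∑ℕ.sum (λ i → f i j))     ≡⟨ sumFin-cong n (λ j → sym (sumFin≡sum m _)) ⟩
  sumFin n (λ j → sumFin m (λ i → f i j))   ∎
  where open ≡-Reasoning

sumFin-permute : ∀ n (f : Fin n → ℕ) (π : Permutation′ n) →
                 sumFin n f ≡ sumFin n (λ i → f (π ⟨$⟩ʳ i))
sumFin-permute n f π =
  trans (sumFin≡sum n f) (trans (∑ℕ.∑-permute f π) (sym (sumFin≡sum n _)))

sumFin-select : ∀ n (f : Fin n → Bool) (k : Fin n) →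
                sumFin n (λ j → indicator (f j ∧ does (j Fin.≟ k))) ≡ indicator (f k)
sumFin-select (suc n) f Fin.zero =
  trans (cong₂ _+_ (cong indicator (∧-identityʳ (f Fin.zero))) others) (+-identityʳ _)
  where
  others : sumFin n (λ j → indicator (f (Fin.suc j) ∧ false)) ≡ 0
  others = trans (sumFin-cong n (λ j → cong indicator (∧-zeroʳ (f (Fin.suc j)))))
                 (trans (sumFin-const n 0) (*-zeroʳ n))
sumFin-select (suc n) f (Fin.suc k) =
  cong₂ _+_ (cong indicator (∧-zeroʳ (f Fin.zero))) (sumFin-select n (f ∘ Fin.suc) k)

indicator-complement : ∀ b → indicator b + indicator (not b) ≡ 1
indicator-complement true  = refl
indicator-complement false = refl

indicator-∨ : ∀ a b → a ∧ b ≡ false → indicator (a ∨ b) ≡ indicator a + indicator b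
indicator-∨ true  true  ()
indicator-∨ true  false _ = refl
indicator-∨ false b     _ = refl

<?-flip : ∀ m n → m ≢ n → does (n <? m) ≡ not (does (m <? n))
<?-flip m n m≢n = does-⇔ (mk⇔ (λ n<m m<n → <-asym n<m m<n)
                               (λ m≮n → ≤∧≢⇒< (≮⇒≥ m≮n) (m≢n ∘ sym)))
                         (n <? m) (¬? (m <? n))

module Counting {n : ℕ} {A : Set} (enum : Fin n ↔ A) where
  open Inverse enum using (to; from; inverseˡ; inverseʳ; strictlyInverseˡ)

  sum : (A → ℕ) → ℕ
  sum g = sumFin n (g ∘ to)

  count : (A → Bool) → ℕ
  count P = sum (indicator ∘ P)

  sum-cong : ∀ {g h : A → ℕ} → g ≗ h → sum g ≡ sum h
  sum-cong g≗h = sumFin-cong n (g≗h ∘ to)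

  sum-distrib-+ : ∀ (g h : A → ℕ) → sum (λ x → g x + h x) ≡ sum g + sum h
  sum-distrib-+ g h = sumFin-distrib-+ n (g ∘ to) (h ∘ to)

  count-cong : ∀ {P Q : A → Bool} → P ≗ Q → count P ≡ count Q
  count-cong P≗Q = sum-cong (cong indicator ∘ P≗Q)

  count-false : count (λ _ → false) ≡ 0
  count-false = trans (sumFin-const n 0) (*-zeroʳ n)

  count-true : count (λ _ → true) ≡ n
  count-true = trans (sumFin-const n 1) (*-identityʳ n)

  count-complement : ∀ P → count P + count (not ∘ P) ≡ n
  count-complement P = begin
    count P + count (not ∘ P)
      ≡⟨ sym (sum-distrib-+ (indicator ∘ P) (indicator ∘ not ∘ P)) ⟩
    sum (λ x → indicator (P x) + indicator (not (P x)))
      ≡⟨ sum-cong (indicator-complement ∘ P) ⟩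
    count (λ _ → true)
      ≡⟨ count-true ⟩
    n ∎
    where open ≡-Reasoning

  count-∨ : ∀ P Q → (∀ x → P x ∧ Q x ≡ false) →
            count (λ x → P x ∨ Q x) ≡ count P + count Q
  count-∨ P Q disjoint =
    trans (sum-cong (λ x → indicator-∨ (P x) (Q x) (disjoint x)))
          (sum-distrib-+ (indicator ∘ P) (indicator ∘ Q))

  count-bijection : ∀ (σ : A ↔ A) P → count (P ∘ Inverse.to σ) ≡ count P
  count-bijection σ P = sym (begin
    count P
      ≡⟨ sumFin-permute n _ π ⟩
    sumFin n (λ i → indicator (P (to (π ⟨$⟩ʳ i))))
      ≡⟨ sumFin-cong n (λ i → cong (indicator ∘ P) (strictlyInverseˡ _)) ⟩
    count (P ∘ Inverse.to σ) ∎)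
    where
    open ≡-Reasoning
    π : Permutation′ n
    π = ↔-sym enum ↔-∘ (σ ↔-∘ enum)

  module _ (_≟_ : DecidableEquality A) where

    count-∧-≡ : ∀ P a → count (λ x → P x ∧ does (x ≟ a)) ≡ indicator (P a)
    count-∧-≡ P a = begin
      count (λ x → P x ∧ does (x ≟ a))
        ≡⟨ sumFin-cong n (λ i → cong (λ b → indicator (P (to i) ∧ b)) (to≡⇔≡from i)) ⟩
      sumFin n (λ i → indicator (P (to i) ∧ does (i Fin.≟ from a)))
        ≡⟨ sumFin-select n (P ∘ to) (from a) ⟩
      indicator (P (to (from a)))
        ≡⟨ cong (indicator ∘ P) (strictlyInverseˡ a) ⟩
      indicator (P a) ∎
      where
      open ≡-Reasoning
      to≡⇔≡from : ∀ i → does (to i ≟ a) ≡ does (i Fin.≟ from a)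
      to≡⇔≡from i = does-⇔ (mk⇔ (λ e → sym (inverseʳ (sym e))) inverseˡ) (to i ≟ a) (i Fin.≟ from a)

    count-≡ : ∀ a → count (λ x → does (x ≟ a)) ≡ 1
    count-≡ = count-∧-≡ (λ _ → true)

  -- Every x is paired with σ x ≠ x, and exactly one of the two has the smaller index.
  involution⇒even : ∀ (σ : A → A) → (∀ x → σ (σ x) ≡ x) → (∀ x → σ x ≢ x) → 2 ∣ n
  involution⇒even σ σ∘σ≗id σx≢x = divides (count below) (begin
    n                               ≡⟨ sym (count-complement below) ⟩
    count below + count (not ∘ below) ≡⟨ cong (count below +_) below-paired ⟩
    count below + count below       ≡⟨ cong (count below +_) (sym (+-identityʳ (count below))) ⟩
    2 * count below                 ≡⟨ *-comm 2 (count below) ⟩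
    count below * 2                 ∎)
    where
    open ≡-Reasoning
    index : A → ℕ
    index = Fin.toℕ ∘ from
    below : A → Bool
    below x = does (index x <? index (σ x))
    index-σ≢ : ∀ x → index x ≢ index (σ x)
    index-σ≢ x e = σx≢x x (sym (trans (sym (strictlyInverseˡ x)) (inverseˡ (toℕ-injective e))))
    below-σ : ∀ x → below (σ x) ≡ not (below x)
    below-σ x = trans (cong (λ y → does (index (σ x) <? index y)) (σ∘σ≗id x))
                      (<?-flip (index x) (index (σ x)) (index-σ≢ x))
    below-paired : count (not ∘ below) ≡ count below
    below-paired = trans (sym (count-cong below-σ))
                         (count-bijection (mk↔ₛ′ σ σ σ∘σ≗id σ∘σ≗id) below)

count-fibres : ∀ {m n} {A B : Set} (enumA : Fin m ↔ A) (enumB : Fin n ↔ B)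
               (_≟_ : DecidableEquality B) (f : A → B) (P : A → Bool) →
               Counting.count enumA P
                 ≡ Counting.sum enumB (λ y → Counting.count enumA (λ x → P x ∧ does (y ≟ f x)))
count-fibres {m} {n} {A} {B} enumA enumB _≟_ f P = begin
  CA.count P
    ≡⟨ sumFin-cong m (λ i → sym (CB.count-∧-≡ _≟_ (λ _ → P (a i)) (f (a i)))) ⟩
  sumFin m (λ i → sumFin n (λ j → indicator (P (a i) ∧ does (b j ≟ f (a i)))))
    ≡⟨ sumFin-comm m n _ ⟩
  CB.sum (λ y → CA.count (λ x → P x ∧ does (y ≟ f x)))
    ∎
  where
  open ≡-Reasoning
  module CA = Counting enumA
  module CB = Counting enumB
  a : Fin m → A
  a = Inverse.to enumA
  b : Fin n → B
  b = Inverse.to enumB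

module FieldCounting {q : ℕ} (F : FiniteField q) where
  open FiniteField F using (Carrier; enum; _≟_; 0#; 1#; -_; isZeroB; isSquareB)
  open FieldProperties F
  open Counting enum
  private module F = FiniteField F
  open ≡-Reasoning

  ¬2∣q⇒1+1≢0 : ¬ 2 ∣ q → 1# F.+ 1# ≢ 0#
  ¬2∣q⇒1+1≢0 2∤q 1+1≡0 = 2∤q (involution⇒even (F._+ 1#) (1+1≡0⇒x+1+1≡x 1+1≡0) x+1≢x)

  nonzeroSquares : ℕ
  nonzeroSquares = count isNonzeroSquareB

  count-squares : count isSquareB ≡ suc nonzeroSquares
  count-squares = begin
    count isSquareB                               ≡⟨ count-cong isSquareB≡isZeroB∨isNonzeroSquareB ⟩
    count (λ x → isZeroB x ∨ isNonzeroSquareB x)  ≡⟨ count-∨ isZeroB isNonzeroSquareB disjoint ⟩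
    count isZeroB + nonzeroSquares                ≡⟨ cong (_+ nonzeroSquares) (count-≡ _≟_ 0#) ⟩
    suc nonzeroSquares                            ∎
    where
    disjoint : ∀ x → isZeroB x ∧ isNonzeroSquareB x ≡ false
    disjoint x with isZeroB x
    ... | true  = refl
    ... | false = refl

  isNonzeroRootB : Carrier → Carrier → Bool
  isNonzeroRootB y x = not (isZeroB x) ∧ does (y ≟ (x F.* x))

  count-nonzeroRoots-none : ∀ y → (∀ x → x ≢ 0# → y ≢ (x F.* x)) → count (isNonzeroRootB y) ≡ 0
  count-nonzeroRoots-none y no-root = trans (count-cong not-root) count-false
    where
    not-root : ∀ x → isNonzeroRootB y x ≡ false
    not-root x = dec-false (¬? (x ≟ 0#) ×-dec (y ≟ (x F.* x))) (λ (x≢0 , y≡xx) → no-root x x≢0 y≡xx)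

  module OddCharacteristic (1+1≢0 : 1# F.+ 1# ≢ 0#) where

    count-nonzeroRoots-square : ∀ a → a ≢ 0# → count (isNonzeroRootB (a F.* a)) ≡ 2
    count-nonzeroRoots-square a a≢0 = begin
      count (isNonzeroRootB (a F.* a))
        ≡⟨ count-cong ±a ⟩
      count (λ x → does (x ≟ a) ∨ does (x ≟ (- a)))
        ≡⟨ count-∨ (λ x → does (x ≟ a)) (λ x → does (x ≟ (- a))) disjoint ⟩
      count (λ x → does (x ≟ a)) + count (λ x → does (x ≟ (- a)))
        ≡⟨ cong₂ _+_ (count-≡ _≟_ a) (count-≡ _≟_ (- a)) ⟩
      2 ∎
      where
      ±a : ∀ x → isNonzeroRootB (a F.* a) x ≡ does (x ≟ a) ∨ does (x ≟ (- a))
      ±a x = does-⇔ (mk⇔ (λ (_ , aa≡xx) → x*x≡y*y⇒x≡y⊎x≡-y x a (sym aa≡xx))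
                         λ { (inj₁ refl) → a≢0 , refl
                           ; (inj₂ refl) → x≢0⇒-x≢0 a a≢0 , sym (-x*-x≡x*x a) })
                    (¬? (x ≟ 0#) ×-dec ((a F.* a) ≟ (x F.* x))) ((x ≟ a) ⊎-dec (x ≟ (- a)))
      disjoint : ∀ x → does (x ≟ a) ∧ does (x ≟ (- a)) ≡ false
      disjoint x = dec-false ((x ≟ a) ×-dec (x ≟ (- a)))
                             (λ (x≡a , x≡-a) → 1+1≢0⇒x≢-x 1+1≢0 a a≢0 (trans (sym x≡a) x≡-a))

    count-nonzeroRoots : ∀ y → count (isNonzeroRootB y)
                               ≡ indicator (isNonzeroSquareB y) + indicator (isNonzeroSquareB y)
    count-nonzeroRoots y with y ≟ 0#
    ... | yes refl = count-nonzeroRoots-none 0# (λ x x≢0 0≡xx → x≢0⇒x*x≢0 x x≢0 (sym 0≡xx))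
    ... | no  y≢0  = bySquareness (isSquareB y) refl
      where
      bySquareness : ∀ b → isSquareB y ≡ b → count (isNonzeroRootB y) ≡ indicator b + indicator b
      bySquareness false y-nonsquare = count-nonzeroRoots-none y (λ x _ y≡xx →
        contradiction (trans (sym (IsSquare⇒isSquareB (x , sym y≡xx))) y-nonsquare) λ ())
      bySquareness true y-square with isSquareB⇒IsSquare y-square
      ... | a , refl =
        count-nonzeroRoots-square a (λ a≡0 → y≢0 (trans (cong (λ u → u F.* u) a≡0) (zeroˡ 0#)))

    q≡1+2*nonzeroSquares : q ≡ suc (nonzeroSquares + nonzeroSquares)
    q≡1+2*nonzeroSquares = begin
      q
        ≡⟨ sym (count-complement isZeroB) ⟩
      count isZeroB + count (not ∘ isZeroB)
        ≡⟨ cong₂ _+_ (count-≡ _≟_ 0#) (count-fibres enum enum _≟_ (λ x → x F.* x) (not ∘ isZeroB)) ⟩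
      suc (sum (λ y → count (isNonzeroRootB y)))
        ≡⟨ cong suc (sum-cong count-nonzeroRoots) ⟩
      suc (sum (λ y → indicator (isNonzeroSquareB y) + indicator (isNonzeroSquareB y)))
        ≡⟨ cong suc (sum-distrib-+ (indicator ∘ isNonzeroSquareB) (indicator ∘ isNonzeroSquareB)) ⟩
      suc (nonzeroSquares + nonzeroSquares) ∎

    count-nonsquares : count (not ∘ isSquareB) ≡ nonzeroSquares
    count-nonsquares = +-cancelˡ-≡ (suc nonzeroSquares) _ _ (begin
      suc nonzeroSquares + count (not ∘ isSquareB) ≡⟨ cong (_+ count (not ∘ isSquareB)) (sym count-squares) ⟩
      count isSquareB + count (not ∘ isSquareB)    ≡⟨ count-complement isSquareB ⟩
      q                                            ≡⟨ q≡1+2*nonzeroSquares ⟩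
      suc nonzeroSquares + nonzeroSquares          ∎)

prime∣m^e⇒prime∣m : ∀ {p} m e → Prime p → p ∣ m ^ e → p ∣ m
prime∣m^e⇒prime∣m m zero    p-prime p∣1 = ⊥-elim (¬prime[1] (subst Prime (∣1⇒≡1 p∣1) p-prime))
prime∣m^e⇒prime∣m m (suc e) p-prime p∣m*mᵉ =
  [ id , prime∣m^e⇒prime∣m m e p-prime ]′ (euclidsLemma m (m ^ e) p-prime p∣m*mᵉ)

4∣evenPrimePower : ∀ {n} → IsPrimePower n → 2 ∣ n → 3 ≤ n → 4 ∣ n
4∣evenPrimePower (p , e , p-prime , _ , refl) 2∣pᵉ 3≤pᵉ
  with prime⇒irreducible p-prime (prime∣m^e⇒prime∣m p e prime[2] 2∣pᵉ)
... | inj₂ refl = 4∣2ᵉ e 3≤pᵉ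
  where
  4∣2ᵉ : ∀ e → 3 ≤ 2 ^ e → 4 ∣ 2 ^ e
  4∣2ᵉ (suc (suc e)) _ = subst (4 ∣_) (*-assoc 2 2 (2 ^ e)) (m∣m*n (2 ^ e))
  4∣2ᵉ zero          (s≤s ())
  4∣2ᵉ (suc zero)    (s≤s (s≤s ()))

twinPrimePowers-odd : ∀ m → IsPrimePower m → IsPrimePower (m + 2) → 3 ≤ m → ¬ 2 ∣ m
twinPrimePowers-odd m m-primePower m+2-primePower 3≤m 2∣m = 4≰2 (∣⇒≤ (∣m+n∣m⇒∣n 4∣m+2 4∣m))
  where
  4∣m : 4 ∣ m
  4∣m = 4∣evenPrimePower m-primePower 2∣m 3≤m
  4∣m+2 : 4 ∣ m + 2
  4∣m+2 = 4∣evenPrimePower m+2-primePower (∣m∣n⇒∣m+n 2∣m ∣-refl) (≤-trans 3≤m (m≤m+n m 2))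
  4≰2 : ¬ 4 ≤ 2
  4≰2 (s≤s (s≤s ()))

-- The right-hand side is ((k - t) + t + ℓ) · 2 + 1, so that in blockSize-arithmetic the
-- truncated subtractions and the division cancel one at a time.
square-of-odd : ∀ s → (3 + (s + s)) * (3 + (s + s))
                      ≡ 1 + ((s * (2 + (s + s)) + (1 + (s + s))) + (3 + (s + s))) * 2
square-of-odd = solve-∀

blockSize-arithmetic : ∀ ℓ s → ℓ ≡ 3 + (s + s) →
                       s * (ℓ ∸ 1) ≡ ((ℓ * ℓ ∸ 1) / 2 ∸ ℓ) ∸ (ℓ ∸ 2)
blockSize-arithmetic ℓ s refl = sym (begin
  ((ℓ * ℓ ∸ 1) / 2 ∸ ℓ) ∸ (ℓ ∸ 2)
    ≡⟨ cong (λ m → ((m ∸ 1) / 2 ∸ ℓ) ∸ (ℓ ∸ 2)) (square-of-odd s) ⟩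
  (((a + (ℓ ∸ 2)) + ℓ) * 2 / 2 ∸ ℓ) ∸ (ℓ ∸ 2)
    ≡⟨ cong (λ m → (m ∸ ℓ) ∸ (ℓ ∸ 2)) (m*n/n≡m ((a + (ℓ ∸ 2)) + ℓ) 2) ⟩
  ((a + (ℓ ∸ 2)) + ℓ ∸ ℓ) ∸ (ℓ ∸ 2)
    ≡⟨ cong (_∸ (ℓ ∸ 2)) (m+n∸n≡m (a + (ℓ ∸ 2)) ℓ) ⟩
  (a + (ℓ ∸ 2)) ∸ (ℓ ∸ 2)
    ≡⟨ m+n∸n≡m a (ℓ ∸ 2) ⟩
  a ∎)
  where
  open ≡-Reasoning
  a : ℕ
  a = s * (ℓ ∸ 1)

module SecondCoordinateColouring {q ℓ : ℕ} (F : FiniteField q) (G : FiniteField ℓ) where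
  open DesignD F G
  private
    module F = FiniteField F
    module G = FiniteField G
    module F′ = FieldProperties F
    module G′ = FieldProperties G
  open Counting F.enum using (count; count-cong; count-true; count-bijection)
  open ≡-Reasoning

  colour : Point → Fin ℓ
  colour (_ , y) = Inverse.from G.enum y

  colour-surjective : IsColouring colour
  colour-surjective k = (F.0# , G.element k) , Inverse.strictlyInverseʳ G.enum k

  rowSize : G.Carrier → ℕ
  rowSize y = count (λ x → inD (x , y))

  countIn-colour : ∀ z₁ z₂ k → countIn colour (z₁ , z₂) k ≡ rowSize (G.element k G.- z₂)
  countIn-colour z₁ z₂ k = begin
    countIn colour (z₁ , z₂) k
      ≡⟨ sumFin-cong q (select-colour ∘ F.element) ⟩
    count (λ x → inD (x F.- z₁ , G.element k G.- z₂))
      ≡⟨ count-bijection (F′.subtract z₁) (λ x → inD (x , G.element k G.- z₂)) ⟩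
    rowSize (G.element k G.- z₂) ∎
    where
    inBlockAt : F.Carrier → Fin ℓ → Bool
    inBlockAt x j = inBlock (z₁ , z₂) (x , G.element j)
    select-colour : ∀ x → sumFin ℓ (λ j → indicator (inBlockAt x j ∧ does (colour (x , G.element j) Fin.≟ k)))
                          ≡ indicator (inBlockAt x k)
    select-colour x = trans
      (sumFin-cong ℓ (λ j → cong (λ c → indicator (inBlockAt x j ∧ does (c Fin.≟ k)))
                                 (Inverse.strictlyInverseʳ G.enum j)))
      (sumFin-select ℓ (inBlockAt x) k)

  inD-zeroRow : ∀ x → inD (x , G.0#) ≡ true
  inD-zeroRow x rewrite dec-true (G.0# G.≟ G.0#) refl
                      | ∨-zeroʳ (not (F.isSquareB x) ∧ not (G.isSquareB G.0#)) = ∨-zeroʳ _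

  inD-squareRow : ∀ x y → y ≢ G.0# → G.isSquareB y ≡ true → inD (x , y) ≡ F′.isNonzeroSquareB x
  inD-squareRow x y y≢0 y-square
    rewrite dec-false (y G.≟ G.0#) y≢0 | y-square
          | ∧-identityʳ (F.isSquareB x) | ∧-zeroʳ (not (F.isSquareB x)) = ∨-identityʳ _

  inD-nonsquareRow : ∀ x y → y ≢ G.0# → G.isSquareB y ≡ false → inD (x , y) ≡ not (F.isSquareB x)
  inD-nonsquareRow x y y≢0 y-nonsquare
    rewrite dec-false (y G.≟ G.0#) y≢0 | y-nonsquare
          | ∧-zeroʳ (F.isSquareB x) | ∧-zeroʳ (not (F.isZeroB x))
          | ∧-identityʳ (not (F.isSquareB x)) = ∨-identityʳ _

  rowSize-zero : rowSize G.0# ≡ q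
  rowSize-zero = trans (count-cong inD-zeroRow) count-true

  module _ (1+1≢0 : F.1# F.+ F.1# ≢ F.0#) where
    open FieldCounting F using (nonzeroSquares)
    open FieldCounting.OddCharacteristic F 1+1≢0 using (count-nonsquares)

    rowSize-nonzero : ∀ y → y ≢ G.0# → rowSize y ≡ nonzeroSquares
    rowSize-nonzero y y≢0 = bySquareness (G.isSquareB y) refl
      where
      bySquareness : ∀ b → G.isSquareB y ≡ b → rowSize y ≡ nonzeroSquares
      bySquareness true  y-square    = count-cong (λ x → inD-squareRow x y y≢0 y-square)
      bySquareness false y-nonsquare =
        trans (count-cong (λ x → inD-nonsquareRow x y y≢0 y-nonsquare)) count-nonsquares

    colourCounts : ∀ z₁ z₂ → countIn colour (z₁ , z₂) (colour (z₁ , z₂)) ≡ q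
                   × (∀ k → k ≢ colour (z₁ , z₂) → countIn colour (z₁ , z₂) k ≡ nonzeroSquares)
    colourCounts z₁ z₂ = own-colour , other-colour
      where
      own-colour : countIn colour (z₁ , z₂) (colour (z₁ , z₂)) ≡ q
      own-colour = begin
        countIn colour (z₁ , z₂) (colour (z₁ , z₂))
          ≡⟨ countIn-colour z₁ z₂ (colour (z₁ , z₂)) ⟩
        rowSize (G.element (Inverse.from G.enum z₂) G.- z₂)
          ≡⟨ cong (λ y → rowSize (y G.- z₂)) (Inverse.strictlyInverseˡ G.enum z₂) ⟩
        rowSize (z₂ G.- z₂)
          ≡⟨ cong rowSize (G′.-‿inverseʳ z₂) ⟩
        rowSize G.0#
          ≡⟨ rowSize-zero ⟩
        q ∎
      other-colour : ∀ k → k ≢ colour (z₁ , z₂) → countIn colour (z₁ , z₂) k ≡ nonzeroSquares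
      other-colour k k≢colour = trans (countIn-colour z₁ z₂ k) (rowSize-nonzero _ λ y≡0 →
        k≢colour (sym (Inverse.inverseʳ G.enum (sym (G′.x-y≡0⇒x≡y _ _ y≡0)))))

lemma6p3 : (ℓ : ℕ) → 5 ≤ ℓ →
    IsPrimePower ℓ → IsPrimePower (ℓ ∸ 2) →
    (F : FiniteField (ℓ ∸ 2)) → (G : FiniteField ℓ) →
    ∃ λ (c : DesignD.Point F G → Fin ℓ) →
      DesignD.IsULSE F G (((ℓ * ℓ ∸ 1) / 2) ∸ ℓ) (ℓ ∸ 2) c
lemma6p3 ℓ 5≤ℓ ℓ-primePower ℓ-2-primePower F G =
  colour , colour-surjective , divides s (sym s*[ℓ-1]≡k-t) , λ (z₁ , z₂) →
    let (own-colour , other-colour) = colourCounts 1+1≢0 z₁ z₂ in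
    colour (z₁ , z₂) , own-colour , λ k k≢colour →
      trans (cong (_* (ℓ ∸ 1)) (other-colour k k≢colour)) s*[ℓ-1]≡k-t
  where
  module F = FiniteField F
  open SecondCoordinateColouring F G
  ℓ-2+2≡ℓ : (ℓ ∸ 2) + 2 ≡ ℓ
  ℓ-2+2≡ℓ = m∸n+n≡m (≤-trans (s≤s (s≤s z≤n)) 5≤ℓ)
  1+1≢0 : F.1# F.+ F.1# ≢ F.0#
  1+1≢0 = FieldCounting.¬2∣q⇒1+1≢0 F
    (twinPrimePowers-odd (ℓ ∸ 2) ℓ-2-primePower (subst IsPrimePower (sym ℓ-2+2≡ℓ) ℓ-primePower)
                         (∸-monoˡ-≤ 2 5≤ℓ))
  open FieldCounting F using (nonzeroSquares)
  open FieldCounting.OddCharacteristic F 1+1≢0 using (q≡1+2*nonzeroSquares)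
  s : ℕ
  s = nonzeroSquares
  ℓ≡3+2s : ℓ ≡ 3 + (s + s)
  ℓ≡3+2s = trans (sym ℓ-2+2≡ℓ) (trans (cong (_+ 2) q≡1+2*nonzeroSquares) (+-comm (suc (s + s)) 2))
  s*[ℓ-1]≡k-t : s * (ℓ ∸ 1) ≡ ((ℓ * ℓ ∸ 1) / 2 ∸ ℓ) ∸ (ℓ ∸ 2)
  s*[ℓ-1]≡k-t = blockSize-arithmetic ℓ s ℓ≡3+2s
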